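{- Let $\Delta$ be a dynamic theory and $p$ a program. Let $\mu,\nu,\tilde\mu\in S$ be such that $\{v\in\mathcal V:\mathrm{val}(\mu,v)\neq\mathrm{val}(\nu,v)\}$ is finite. If $\mu=_W\nu$ for some $W\supseteq\mathrm{FV}^{sem}(p)$ and $(\mu,\tilde\mu)\in\mathcal E_P(p)$, then there exists $\tilde\nu\in S$ with $(\nu,\tilde\nu)\in\mathcal E_P(p)$ and $\tilde\mu=_W\tilde\nu$. Moreover, $\mathrm{FV}^{sem}(p)$ is the smallest set with this property: if $X\subseteq\mathcal V$ is such that the preceding statement holds with $\mathrm{FV}^{sem}(p)$ replaced by $X$, then $\mathrm{FV}^{sem}(p)\subseteq X$.
   Context: A dynamic theory $\Delta$ consists of: pairwise disjoint sets $\mathcal V$ (variables), $\mathcal A$ (atoms), $\mathcal P$ (programs); a nonempty set $U$; a nonempty set $S$ of states with $\mathrm{val}:S\times\mathcal V\to U$ satisfying interpolation (for all $\mu,\nu\in S$, $W\subseteq\mathcal V$ there is $\omega\in S$ agreeing with $\mu$ on $W$ and with $\nu$ outside $W$); $\mathcal E_A:\mathcal A\to2^S$ and $\mathrm{FV}_A:\mathcal A\to 2^{\mathcal V}$ with $\mathrm{FV}_A(a)$ finite and states agreeing on $\mathrm{FV}_A(a)$ both in or both out of $\mathcal E_A(a)$; $\mathcal E_P:\mathcal P\to 2^{S\times S}$ and $\mathrm{FV}_P:\mathcal P\to2^{\mathcal V}$ with $\mathrm{FV}_P(p)$ finite, overapproximation (for all $W\supseteq\mathrm{FV}_P(p)$: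 if $\mu=_W\nu$ and $(\mu,\omega)\in\mathcal E_P(p)$ then some $\tilde\omega$ has $(\nu,\tilde\omega)\in\mathcal E_P(p)$, $\omega=_W\tilde\omega$) and extensionality (if $\mu=_{\mathcal V}\nu$ then $(\mu,\omega)\in\mathcal E_P(p)\iff(\nu,\omega)\in\mathcal E_P(p)$). $\mu=_W\nu$ means $\mathrm{val}(\mu,v)=\mathrm{val}(\nu,v)$ for all $v\in W$. $\mathrm{FV}^{sem}(p)=\{v:\exists\mu,\tilde\mu,\nu$ with $\mu=_{\mathcal V\setminus\{v\}}\tilde\mu$, $(\mu,\nu)\in\mathcal E_P(p)$, and there is no $\tilde\nu$ with $\nu=_{\mathcal V\setminus\{v\}}\tilde\nu$ and $(\tilde\mu,\tilde\nu)\in\mathcal E_P(p)\}$. -}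

module Defs where

open import Level using (0ℓ)
open import Data.Product using (Σ; ∃; ∃-syntax; _×_; _,_)
open import Data.List using (List)
open import Data.List.Membership.Propositional using (_∈_)
open import Relation.Binary.PropositionalEquality using (_≡_; _≢_)
open import Relation.Nullary using (¬_)
open import Relation.Unary using (Pred; _⊆_)

-- A dynamic theory.  Variables, atoms and programs are separate types
-- (hence pairwise disjoint).  Subsets of a type are predicates; finite
-- sets of variables (FV_A, FV_P) are given by lists.
record DynamicTheory : Set₁ where
  field
    Var  : Set
    Atom : Set
    Prog : Set
    U    : Set
    S    : Set
    U-nonempty : U
    S-nonempty : S
    val  : S → Var → U

  _=[_]_ : S → Pred Var 0ℓ → S → Set
  μ =[ W ] ν = ∀ v → W v → val μ v ≡ val ν v

  field
    interpolation : ∀ (μ ν : S) (W : Pred Var 0ℓ) →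
      ∃[ ω ] ((∀ v → W v → val ω v ≡ val μ v) × (∀ v → ¬ W v → val ω v ≡ val ν v))

    EA  : Atom → Pred S 0ℓ
    FVA : Atom → List Var
    EA-coincidence : ∀ a μ ν → μ =[ (λ v → v ∈ FVA a) ] ν →
      (EA a μ → EA a ν) × (EA a ν → EA a μ)

    EP  : Prog → S → S → Set
    FVP : Prog → List Var
    overapproximation : ∀ p (W : Pred Var 0ℓ) → (∀ v → v ∈ FVP p → W v) →
      ∀ μ ν ω → μ =[ W ] ν → EP p μ ω → ∃[ ω̃ ] (EP p ν ω̃ × ω =[ W ] ω̃)
    extensionality : ∀ p μ ν → μ =[ (λ _ → Var) ] ν → ∀ ω →
      (EP p μ ω → EP p ν ω) × (EP p ν ω → EP p μ ω)

module Notions (Δ : DynamicTheory) where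
  open DynamicTheory Δ

  allBut : Var → Pred Var 0ℓ
  allBut v w = w ≢ v

  FVsem : Prog → Pred Var 0ℓ
  FVsem p v = ∃[ μ ] ∃[ μ' ] ∃[ ν ]
    (μ =[ allBut v ] μ' × EP p μ ν ×
     ¬ (∃[ ν' ] (ν =[ allBut v ] ν' × EP p μ' ν')))

  FiniteDiff : S → S → Set
  FiniteDiff μ ν = ∃[ L ] (∀ v → val μ v ≢ val ν v → v ∈ L)

  -- "the preceding statement" with FV^sem(p) replaced by X
  CoincidenceProperty : Prog → Pred Var 0ℓ → Set₁
  CoincidenceProperty p X = ∀ (μ ν μ' : S) → FiniteDiff μ ν →
    ∀ (W : Pred Var 0ℓ) → X ⊆ W → μ =[ W ] ν → EP p μ μ' →
    ∃[ ν' ] (EP p ν ν' × μ' =[ W ] ν')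

{-# OPTIONS --safe #-}
module Submission where

-- Changing the initial state at a single variable x ∉ FV^sem(p) can be matched by a
-- run that differs from the old one at most at x: this is the negation of
-- "x ∈ FV^sem(p)", made positive by excluded middle.  As μ and ν differ at finitely
-- many variables, walk from μ to ν copying one of them at a time; variables in W
-- already agree, the others lie outside FV^sem(p), and composing the matched runs
-- gives agreement on W.  Minimality: a witness of x ∈ FV^sem(p) is a pair of states
-- differing only at x, and the property for W = 𝒱 ∖ {x} ⊇ X would produce exactly
-- the run the witness excludes.

open import Defs
open import Level using (0ℓ)
open import Data.Product using (_×_; _,_; ∃-syntax; proj₁; map₂; swap)
open import Data.List using (List; []; _∷_)
open import Data.List.Membership.Propositional using (_∈_)
open import Data.List.Relation.Unary.Any using (here; tail)
open import Data.List.Relation.Unary.Any.Properties using (¬Any[])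
open import Relation.Binary.PropositionalEquality using (_≡_; _≢_; refl; sym; trans)
open import Relation.Nullary using (¬_; yes; no)
open import Relation.Unary using (Pred; _⊆_)
open import Axiom.ExcludedMiddle using (ExcludedMiddle)
open import Axiom.DoubleNegationElimination using (em⇒dne)

module Coincidence (Δ : DynamicTheory) (p : DynamicTheory.Prog Δ) where
  open DynamicTheory Δ
  open Notions Δ

  DiffersWithin : S → S → List Var → Set
  DiffersWithin μ ν L = ∀ v → val μ v ≢ val ν v → v ∈ L

  _⇝[_]_ : S → Pred Var 0ℓ → S → Set
  μ ⇝[ W ] ν = ∀ μ' → EP p μ μ' → ∃[ ν' ] (EP p ν ν' × μ' =[ W ] ν')

  ⊆allBut : ∀ {W : Pred Var 0ℓ} {x} → ¬ W x → W ⊆ allBut x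
  ⊆allBut ¬Wx Wv refl = ¬Wx Wv

  =[]-byCases : ExcludedMiddle 0ℓ → ∀ {W μ ν} x →
    (W x → val μ x ≡ val ν x) → (∀ v → v ≢ x → W v → val μ v ≡ val ν v) → μ =[ W ] ν
  =[]-byCases lem x at-x off-x v Wv with lem {v ≡ x}
  ... | yes refl = at-x Wv
  ... | no v≢x   = off-x v v≢x Wv

  ⇝-trans : ∀ {W μ ω ν} → μ ⇝[ W ] ω → ω ⇝[ W ] ν → μ ⇝[ W ] ν
  ⇝-trans μ⇝ω ω⇝ν μ' run with μ⇝ω μ' run
  ... | ω' , runω , μ'≈ω' with ω⇝ν ω' runω
  ... | ν' , runν , ω'≈ν' = ν' , runν , λ v Wv → trans (μ'≈ω' v Wv) (ω'≈ν' v Wv)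

  ⇝-mono : ∀ {V W μ ν} → V ⊆ W → μ ⇝[ W ] ν → μ ⇝[ V ] ν
  ⇝-mono V⊆W μ⇝ν μ' run = map₂ (map₂ λ μ'≈ν' v Vv → μ'≈ν' v (V⊆W Vv)) (μ⇝ν μ' run)

  agreeEverywhere⇒⇝ : ∀ {W μ ν} → μ =[ (λ _ → Var) ] ν → μ ⇝[ W ] ν
  agreeEverywhere⇒⇝ μ≈ν μ' run = μ' , proj₁ (extensionality p _ _ μ≈ν μ') run , λ _ _ → refl

  ∉FVsem⇒⇝ : ExcludedMiddle 0ℓ → ∀ {x μ ω} → ¬ FVsem p x →
    μ =[ allBut x ] ω → μ ⇝[ allBut x ] ω
  ∉FVsem⇒⇝ lem x∉FV μ≈ω μ' run =
    map₂ swap (em⇒dne lem λ noMatch → x∉FV (_ , _ , μ' , μ≈ω , run , noMatch))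

  differsWithin⇒⇝ : ExcludedMiddle 0ℓ → ∀ {W} → FVsem p ⊆ W →
    ∀ L {μ ν} → DiffersWithin μ ν L → μ =[ W ] ν → μ ⇝[ W ] ν
  differsWithin⇒⇝ lem _ [] diff _ =
    agreeEverywhere⇒⇝ λ v _ → em⇒dne lem λ μv≢νv → ¬Any[] (diff v μv≢νv)
  differsWithin⇒⇝ lem {W} FV⊆W (x ∷ L) {μ} {ν} diff μ≈ν
    with interpolation ν μ (_≡ x)  -- ω is μ with the value at x copied from ν
  ... | ω , ω≈ν-at-x , ω≈μ = ⇝-trans μ⇝ω (differsWithin⇒⇝ lem FV⊆W L ω-diff ω≈ν)
    where
    μ⇝ω : μ ⇝[ W ] ω
    μ⇝ω with lem {W x}
    ... | yes Wx = agreeEverywhere⇒⇝ (=[]-byCases lem x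
                     (λ _ → trans (μ≈ν x Wx) (sym (ω≈ν-at-x x refl)))
                     (λ v v≢x _ → sym (ω≈μ v v≢x)))
    ... | no ¬Wx = ⇝-mono (⊆allBut ¬Wx)
                     (∉FVsem⇒⇝ lem (λ x∈FV → ¬Wx (FV⊆W x∈FV)) (λ v v≢x → sym (ω≈μ v v≢x)))

    ω≈ν : ω =[ W ] ν
    ω≈ν = =[]-byCases lem x (λ _ → ω≈ν-at-x x refl)
            (λ v v≢x Wv → trans (ω≈μ v v≢x) (μ≈ν v Wv))

    ω-diff : DiffersWithin ω ν L
    ω-diff v ωv≢νv = tail v≢x (diff v λ μv≡νv → ωv≢νv (trans (ω≈μ v v≢x) μv≡νv))
      where
      v≢x : v ≢ x
      v≢x v≡x = ωv≢νv (ω≈ν-at-x v v≡x)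

  allBut⇒FiniteDiff : ExcludedMiddle 0ℓ → ∀ {x μ ν} → μ =[ allBut x ] ν → FiniteDiff μ ν
  allBut⇒FiniteDiff lem {x} μ≈ν = x ∷ [] , λ v μv≢νv → here (em⇒dne lem λ v≢x → μv≢νv (μ≈ν v v≢x))

  FVsem-coincides : ExcludedMiddle 0ℓ → CoincidenceProperty p (FVsem p)
  FVsem-coincides lem μ ν μ' (L , diff) W FV⊆W μ≈ν = differsWithin⇒⇝ lem FV⊆W L diff μ≈ν μ'

  FVsem-minimal : ExcludedMiddle 0ℓ → ∀ X → CoincidenceProperty p X → FVsem p ⊆ X
  FVsem-minimal lem X coincides (μ , μ̃ , ν , μ≈μ̃ , run , noMatch) = em⇒dne lem λ ¬Xx →
    noMatch (map₂ swap (coincides μ μ̃ ν (allBut⇒FiniteDiff lem μ≈μ̃) _ (⊆allBut ¬Xx) μ≈μ̃ run))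

mainTheorem3 : ExcludedMiddle 0ℓ → (Δ : DynamicTheory) → (p : DynamicTheory.Prog Δ) →
    Notions.CoincidenceProperty Δ p (Notions.FVsem Δ p) ×
    (∀ (X : Pred (DynamicTheory.Var Δ) 0ℓ) → Notions.CoincidenceProperty Δ p X → Notions.FVsem Δ p ⊆ X)
mainTheorem3 lem Δ p = FVsem-coincides lem , FVsem-minimal lem
  where open Coincidence Δ p
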